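{- Let $d\ge 1$ and let $v=v_1\cdots v_d$ and $w=w_1\cdots w_d$ be two permutations in $\mathcal{S}_d$ (viewed as patterns). Suppose that $\mathcal{O}_v=\mathcal{O}_w$ and that for every $i\in\mathcal{O}_v$, $$\{v_1,\dots,v_{d-i}\}=\{w_1,\dots,w_{d-i}\}\quad\text{and}\quad \{v_{i+1},\dots,v_d\}=\{w_{i+1},\dots,w_d\}.$$ Then $v$ and $w$ are strongly c-Wilf-equivalent in words (and in particular c-Wilf-equivalent in words), i.e. $g_r^v([k]^n)=g_r^w([k]^n)$ for all $k,n\in\mathbb{N}$ and all $r\in\mathbb{N}_0$.
   Context: For $k\in\mathbb{N}$, $[k]=\{1,\dots,k\}$ and $[k]^n$ is the set of words $u=u_1\cdots u_n$ of length $n$ with letters in $[k]$. For $v\in\mathcal{S}_d$ and a word $u$, a consecutive occurrence of $v$ in $u$ is an index $j$ with $1\le j\le n-d+1$ such that $u_j u_{j+1}\cdots u_{j+d-1}$ is order-isomorphic to $v$, i.e. for all $1\le p,q\le d$: $u_{j+p-1}<u_{j+q-1}\iff v_p<v_q$ and $u_{j+p-1}=u_{j+q-1}\iff v_p=v_q$. Let $\mathrm{con}_v(u)$ be the number of consecutive occurrences of $v$ in $u$, and $g_r^v([k]^n)=\#\{u\in[k]^n:\mathrm{con}_v(u)=r\}$. The overlap set $\mathcal{O}_v$ is the set of indices $i$ with $1\le i<d$ such that $v_1\cdots v_i$ and $v_{d-i+1}\cdots v_d$ are order-isomorphic. Two patterns $v,w$ are c-Wilf-equivalent in words if $g_0^v([k]^n)=g_0^w([k]^n)$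 for all $k,n\in\mathbb{N}$, and strongly c-Wilf-equivalent in words if $g_r^v([k]^n)=g_r^w([k]^n)$ for all $k,n\in\mathbb{N}$ and $r\in\mathbb{N}_0$. -}

module Defs where

open import Data.Nat using (ℕ; zero; suc; _+_; _∸_; _<_; _≤_; _<ᵇ_; _≡ᵇ_; _<?_)
open import Data.Fin using (Fin; toℕ; fromℕ<)
open import Data.Fin.Permutation using (Permutation′; _⟨$⟩ʳ_)
open import Data.Bool using (Bool; true; false; _∧_; if_then_else_)
open import Data.List using (List; []; _∷_; allFin; foldr; length; filter; map; concatMap; cartesianProduct)
open import Data.Vec using (Vec; []; _∷_; lookup; toList)
import Data.Vec as V
open import Data.Maybe using (Maybe; just; nothing)
open import Data.Product using (Σ; _×_; _,_; ∃; proj₁; proj₂)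
open import Relation.Nullary using (yes; no)
open import Relation.Binary.PropositionalEquality using (_≡_)
open import Function.Bundles using (_⇔_)

_==_ : Bool → Bool → Bool
true == b = b
false == true = false
false == false = true

-- Patterns.  A permutation v ∈ S_d is a bijection Fin d → Fin d; its
-- p-th letter (0-indexed) is  toℕ (v ⟨$⟩ʳ p)  (i.e. v_{p+1} - 1, the
-- shift by one is irrelevant for everything below).

letter : ∀ {d} → Permutation′ d → Fin d → ℕ
letter v p = toℕ (v ⟨$⟩ʳ p)

-- v as a function on ℕ (0-indexed positions; junk value 0 outside [0,d))
at : ∀ {d} → Permutation′ d → ℕ → ℕ
at {d} v m with m <? d
... | yes m<d = letter v (fromℕ< m<d)
... | no _ = 0

allᵇ : {A : Set} → (A → Bool) → List A → Bool
allᵇ P = foldr (λ x b → P x ∧ b) true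

orderIsoᵇ : ∀ {d} → (Fin d → ℕ) → (Fin d → ℕ) → Bool
orderIsoᵇ {d} a b =
  allᵇ (λ pq → let p = proj₁ pq ; q = proj₂ pq in
         ((a p <ᵇ a q) == (b p <ᵇ b q)) ∧ ((a p ≡ᵇ a q) == (b p ≡ᵇ b q)))
      (cartesianProduct (allFin d) (allFin d))

window : (d : ℕ) → List ℕ → Maybe (Vec ℕ d)
window zero xs = just []
window (suc d) [] = nothing
window (suc d) (x ∷ xs) with window d xs
... | just ys = just (x ∷ ys)
... | nothing = nothing

occursHere : ∀ {d} → Permutation′ d → List ℕ → Bool
occursHere {d} v xs with window d xs
... | just ys = orderIsoᵇ (lookup ys) (letter v)
... | nothing = false

conList : ∀ {d} → Permutation′ d → List ℕ → ℕ
conList v [] = 0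
conList v (x ∷ xs) = (if occursHere v (x ∷ xs) then 1 else 0) + conList v xs

-- words in [k]^n, letters represented by Fin k (0-indexed; order preserved)
Word : ℕ → ℕ → Set
Word k n = Vec (Fin k) n

con : ∀ {d k n} → Permutation′ d → Word k n → ℕ
con v u = conList v (toList (V.map toℕ u))

allWords : (k n : ℕ) → List (Word k n)
allWords k zero = [] ∷ []
allWords k (suc n) = concatMap (λ a → map (a ∷_) (allWords k n)) (allFin k)

g : ∀ {d} → ℕ → Permutation′ d → (k n : ℕ) → ℕ
g r v k n = length (filter (λ u → con v u Data.Nat.≟ r) (allWords k n))

IsoFactors : (ℕ → ℕ) → ℕ → (ℕ → ℕ) → ℕ → ℕ → Set
IsoFactors f a h b i = ∀ p q → p < i → q < i →
  ((f (a + p) < f (a + q)) ⇔ (h (b + p) < h (b + q))) ×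
  ((f (a + p) ≡ f (a + q)) ⇔ (h (b + p) ≡ h (b + q)))

InOverlap : ∀ {d} → Permutation′ d → ℕ → Set
InOverlap {d} v i = 1 ≤ i × i < d × IsoFactors (at v) 0 (at v) (d ∸ i) i

LetterSet : ∀ {d} → Permutation′ d → ℕ → ℕ → ℕ → Set
LetterSet v lo hi x = ∃ λ p → lo ≤ p × p < hi × at v p ≡ x

StronglyCWilfEquiv : ∀ {d} → Permutation′ d → Permutation′ d → Set
StronglyCWilfEquiv v w = ∀ (k n r : ℕ) → g r v k n ≡ g r w k n

-- Mark a set B of consecutive occurrences of v in a word u and, inside every marked factor,
-- permute the positions by the relabelling σ = v⁻¹ ∘ w, so that each marked factor becomes an
-- occurrence of w. Two marked occurrences at distance s overlap in i = d − s positions, so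
-- i ∈ O_v = O_w; the letter-set conditions then force σ to commute with the shift by s on the
-- overlap, so the rearrangement is well defined. It is a bijection between the words in which B
-- marks occurrences of v and those in which B marks occurrences of w. Summing over B,
-- ∑_u (1 + x) ^ con_v(u) = ∑_B x ^ |B| · #{u : B marks occurrences of v in u}
-- is the same polynomial for v and for w, and its coefficients are the numbers g_r.

module Submission where

open import Defs
open import Data.Nat using (ℕ; zero; suc; _+_; _*_; _∸_; _^_; _≤_; _<_; z≤n; s≤s; s≤s⁻¹; _<ᵇ_; _≡ᵇ_; _%_; NonZero)
open import Data.Nat.Properties
open import Data.Nat.DivMod using ([m+kn]%n≡m%n; m<n⇒m%n≡m)
open import Data.Bool using (Bool; true; false; _∧_; T; T?)
open import Data.Bool.Properties using (T-∧)
open import Data.Empty using (⊥-elim)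
open import Data.Sum using (inj₁; inj₂)
open import Data.Product using (Σ; ∃; _×_; _,_; proj₁; proj₂; uncurry)
open import Data.Maybe using (just; nothing)
open import Data.List using (List; []; _∷_; _++_; map; concat; filter; length; drop; upTo; allFin; cartesianProduct; cartesianProductWith)
open import Data.List.Properties using (length-map; length-drop)
open import Data.List.Membership.Propositional using (_∈_)
open import Data.List.Membership.Propositional.Properties
  using (∈-filter⁺; ∈-filter⁻; ∈-map⁻; ∈-map⁺; ∈-upTo⁺; ∈-upTo⁻; ∈-allFin;
         ∈-cartesianProduct⁺; ∈-cartesianProductWith⁺)
open import Data.List.Membership.Propositional.Properties.WithK using (unique∧set⇒bag)
open import Data.List.Relation.Unary.Any using (here; there)
import Data.List.Relation.Unary.All as All
open import Data.List.Relation.Unary.AllPairs using (AllPairs; []; _∷_)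
import Data.List.Relation.Unary.AllPairs.Properties as AllPairs
open import Data.List.Relation.Unary.Unique.Propositional using (Unique)
import Data.List.Relation.Unary.Unique.Propositional.Properties as Unique
open import Data.List.Relation.Binary.BagAndSetEquality using (∼bag⇒↭)
open import Data.List.Relation.Binary.Permutation.Propositional.Properties using (↭-length)
open import Data.Vec using (Vec; []; _∷_; lookup; tabulate; toList)
import Data.Vec as Vec
open import Data.Vec.Properties using (lookup∘tabulate; tabulate∘lookup; tabulate-cong; ∷-injective)
open import Data.Fin using (Fin; toℕ; fromℕ<) renaming (zero to fzero; suc to fsuc)
open import Data.Fin.Properties using (toℕ<n; toℕ-fromℕ<; fromℕ<-toℕ; toℕ-injective)
open import Data.Fin.Permutation using (Permutation′; _⟨$⟩ʳ_; _⟨$⟩ˡ_; inverseˡ; flip; _∘ₚ_)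
open import Relation.Nullary using (Dec; does; yes; no; ¬_; _×-dec_)
open import Relation.Binary.Definitions using (tri<; tri≈; tri>)
open import Relation.Binary.PropositionalEquality using (_≡_; refl; sym; trans; cong; cong₂; subst; subst₂; _≢_; module ≡-Reasoning)
open import Function.Bundles using (_⇔_; mk⇔; Equivalence)
open import Function.Construct.Symmetry using (⇔-sym)
open import Function.Construct.Composition using (_⇔-∘_)
open import Algebra.Properties.CommutativeSemigroup +-commutativeSemigroup using (interchange)

private variable
  A B : Set
  d k n : ℕ

𝟙 : Bool → ℕ
𝟙 true = 1
𝟙 false = 0

∑ : List A → (A → ℕ) → ℕ
∑ [] f = 0
∑ (x ∷ xs) f = f x + ∑ xs f

count : (A → Bool) → List A → ℕ
count P xs = ∑ xs (λ x → 𝟙 (P x))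

∑-cong : (xs : List A) {f g : A → ℕ} → (∀ x → x ∈ xs → f x ≡ g x) → ∑ xs f ≡ ∑ xs g
∑-cong [] eq = refl
∑-cong (x ∷ xs) eq = cong₂ _+_ (eq x (here refl)) (∑-cong xs (λ y y∈ → eq y (there y∈)))

∑-zero : (xs : List A) → ∑ xs (λ _ → 0) ≡ 0
∑-zero [] = refl
∑-zero (x ∷ xs) = ∑-zero xs

∑-+ : (xs : List A) (f g : A → ℕ) → ∑ xs (λ x → f x + g x) ≡ ∑ xs f + ∑ xs g
∑-+ [] f g = refl
∑-+ (x ∷ xs) f g = trans (cong (f x + g x +_) (∑-+ xs f g)) (interchange (f x) (g x) (∑ xs f) (∑ xs g))

∑-++ : (xs ys : List A) (f : A → ℕ) → ∑ (xs ++ ys) f ≡ ∑ xs f + ∑ ys f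
∑-++ [] ys f = refl
∑-++ (x ∷ xs) ys f = trans (cong (f x +_) (∑-++ xs ys f)) (sym (+-assoc (f x) (∑ xs f) (∑ ys f)))

∑-map : (xs : List A) (h : A → B) (f : B → ℕ) → ∑ (map h xs) f ≡ ∑ xs (λ x → f (h x))
∑-map [] h f = refl
∑-map (x ∷ xs) h f = cong (f (h x) +_) (∑-map xs h f)

∑-*ˡ : (xs : List A) (c : ℕ) (f : A → ℕ) → ∑ xs (λ x → c * f x) ≡ c * ∑ xs f
∑-*ˡ [] c f = sym (*-zeroʳ c)
∑-*ˡ (x ∷ xs) c f = trans (cong (c * f x +_) (∑-*ˡ xs c f)) (sym (*-distribˡ-+ c (f x) (∑ xs f)))

∑-comm : (xs : List A) (ys : List B) (f : A → B → ℕ) →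
  ∑ xs (λ x → ∑ ys (f x)) ≡ ∑ ys (λ y → ∑ xs (λ x → f x y))
∑-comm [] ys f = sym (∑-zero ys)
∑-comm (x ∷ xs) ys f =
  trans (cong (∑ ys (f x) +_) (∑-comm xs ys f)) (sym (∑-+ ys (f x) (λ y → ∑ xs (λ x′ → f x′ y))))

count≤length : (P : A → Bool) (xs : List A) → count P xs ≤ length xs
count≤length P [] = z≤n
count≤length P (x ∷ xs) with P x
... | true = s≤s (count≤length P xs)
... | false = m≤n⇒m≤1+n (count≤length P xs)

length-filter : {P : A → Set} (P? : ∀ x → Dec (P x)) (xs : List A) →
  length (filter P? xs) ≡ count (λ x → does (P? x)) xs
length-filter P? [] = refl
length-filter P? (x ∷ xs) with does (P? x)
... | true = cong suc (length-filter P? xs)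
... | false = length-filter P? xs

Unique-map⁺ : (f : A → B) {xs : List A} → (∀ {x x′} → x ∈ xs → x′ ∈ xs → f x ≡ f x′ → x ≡ x′) →
  Unique xs → Unique (map f xs)
Unique-map⁺ f inj xs! = AllPairs.map⁺ (distinct-images inj xs!)
  where
  distinct-images : ∀ {xs} → (∀ {x x′} → x ∈ xs → x′ ∈ xs → f x ≡ f x′ → x ≡ x′) →
    Unique xs → AllPairs (λ x x′ → f x ≢ f x′) xs
  distinct-images inj [] = []
  distinct-images inj (x∉ ∷ xs!) =
    All.tabulate (λ x′∈ fx≡fx′ → All.lookup x∉ x′∈ (inj (here refl) (there x′∈) fx≡fx′))
    ∷ distinct-images (λ x∈ x′∈ → inj (there x∈) (there x′∈)) xs!

record BijectionOn (xs : List A) (P : A → Bool) (ys : List B) (Q : B → Bool) : Set where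
  field
    to : A → B
    from : B → A
    to-∈ : ∀ x → x ∈ xs → T (P x) → to x ∈ ys × T (Q (to x))
    from-∈ : ∀ y → y ∈ ys → T (Q y) → from y ∈ xs × T (P (from y))
    from∘to : ∀ x → x ∈ xs → T (P x) → from (to x) ≡ x
    to∘from : ∀ y → y ∈ ys → T (Q y) → to (from y) ≡ y

count-bijection : {xs : List A} {ys : List B} {P : A → Bool} {Q : B → Bool} →
  Unique xs → Unique ys → BijectionOn xs P ys Q → count P xs ≡ count Q ys
count-bijection {xs = xs} {ys} {P} {Q} xs! ys! bij = begin
  count P xs              ≡⟨ sym (length-filter (λ x → T? (P x)) xs) ⟩
  length xsᴾ              ≡⟨ sym (length-map to xsᴾ) ⟩
  length (map to xsᴾ)     ≡⟨ ↭-length (∼bag⇒↭ (unique∧set⇒bag map-to-unique ysᴾ-unique (mk⇔ to-image from-image))) ⟩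
  length ysᴾ              ≡⟨ length-filter (λ y → T? (Q y)) ys ⟩
  count Q ys              ∎
  where
  open BijectionOn bij
  open ≡-Reasoning
  xsᴾ = filter (λ x → T? (P x)) xs
  ysᴾ = filter (λ y → T? (Q y)) ys
  ysᴾ-unique : Unique ysᴾ
  ysᴾ-unique = Unique.filter⁺ (λ y → T? (Q y)) ys!
  to-injective : ∀ {x x′} → x ∈ xsᴾ → x′ ∈ xsᴾ → to x ≡ to x′ → x ≡ x′
  to-injective x∈ x′∈ eq with ∈-filter⁻ (λ x → T? (P x)) x∈ | ∈-filter⁻ (λ x → T? (P x)) x′∈
  ... | x∈xs , px | x′∈xs , px′ = trans (sym (from∘to _ x∈xs px)) (trans (cong from eq) (from∘to _ x′∈xs px′))
  map-to-unique : Unique (map to xsᴾ)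
  map-to-unique = Unique-map⁺ to to-injective (Unique.filter⁺ (λ x → T? (P x)) xs!)
  to-image : ∀ {y} → y ∈ map to xsᴾ → y ∈ ysᴾ
  to-image y∈ with ∈-map⁻ to y∈
  ... | x , x∈ , refl with ∈-filter⁻ (λ x → T? (P x)) x∈
  ... | x∈xs , px = uncurry (∈-filter⁺ (λ y → T? (Q y))) (to-∈ x x∈xs px)
  from-image : ∀ {y} → y ∈ ysᴾ → y ∈ map to xsᴾ
  from-image {y} y∈ with ∈-filter⁻ (λ y → T? (Q y)) y∈
  ... | y∈ys , qy = subst (_∈ map to xsᴾ) (to∘from y y∈ys qy)
                      (∈-map⁺ to (uncurry (∈-filter⁺ (λ x → T? (P x))) (from-∈ y y∈ys qy)))

𝟙-mono : ∀ {b c} → (T b → T c) → 𝟙 b ≤ 𝟙 c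
𝟙-mono {false} _ = z≤n
𝟙-mono {true} {true} _ = ≤-refl
𝟙-mono {true} {false} b⇒c = ⊥-elim (b⇒c _)

count-mono : {P Q : A → Bool} (xs : List A) → (∀ x → x ∈ xs → T (P x) → T (Q x)) → count P xs ≤ count Q xs
count-mono [] _ = z≤n
count-mono (x ∷ xs) P⇒Q = +-mono-≤ (𝟙-mono (P⇒Q x (here refl))) (count-mono xs (λ y y∈ → P⇒Q y (there y∈)))

count-< : {P Q : A → Bool} (xs : List A) → (∀ x → x ∈ xs → T (P x) → T (Q x)) →
  ∀ {x} → x ∈ xs → ¬ T (P x) → T (Q x) → count P xs < count Q xs
count-< {P = P} {Q} (y ∷ xs) P⇒Q (here refl) ¬Py Qy with P y | Q y
... | false | true = s≤s (count-mono xs (λ z z∈ → P⇒Q z (there z∈)))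
... | true | _ = ⊥-elim (¬Py _)
count-< (y ∷ xs) P⇒Q (there x∈) ¬Px Qx =
  +-mono-≤-< (𝟙-mono (P⇒Q y (here refl))) (count-< xs (λ z z∈ → P⇒Q z (there z∈)) x∈ ¬Px Qx)

-- Base-b expansions

horner : ℕ → (ℕ → ℕ) → ℕ → ℕ
horner b a zero = 0
horner b a (suc R) = a 0 + b * horner b (λ r → a (suc r)) R

horner-zero : ∀ b R → horner b (λ _ → 0) R ≡ 0
horner-zero b zero = refl
horner-zero b (suc R) = trans (cong (b *_) (horner-zero b R)) (*-zeroʳ b)

horner-+ : ∀ b R (a a′ : ℕ → ℕ) → horner b (λ r → a r + a′ r) R ≡ horner b a R + horner b a′ R
horner-+ b zero a a′ = refl
horner-+ b (suc R) a a′ = begin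
  a 0 + a′ 0 + b * horner b (λ r → a (suc r) + a′ (suc r)) R
    ≡⟨ cong (λ h → a 0 + a′ 0 + b * h) (horner-+ b R _ _) ⟩
  a 0 + a′ 0 + b * (horner b (λ r → a (suc r)) R + horner b (λ r → a′ (suc r)) R)
    ≡⟨ cong (a 0 + a′ 0 +_) (*-distribˡ-+ b _ _) ⟩
  a 0 + a′ 0 + (b * horner b (λ r → a (suc r)) R + b * horner b (λ r → a′ (suc r)) R)
    ≡⟨ interchange (a 0) (a′ 0) _ _ ⟩
  horner b a (suc R) + horner b a′ (suc R) ∎
  where open ≡-Reasoning

horner-indicator : ∀ b R c → c < R → horner b (λ r → 𝟙 (c ≡ᵇ r)) R ≡ b ^ c
horner-indicator b (suc R) zero _ = trans (cong (λ h → 1 + b * h) (horner-zero b R)) (cong suc (*-zeroʳ b))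
horner-indicator b (suc R) (suc c) (s≤s c<R) = cong (b *_) (horner-indicator b R c c<R)

∑-pow≡horner : ∀ b R (xs : List A) (e : A → ℕ) → (∀ x → x ∈ xs → e x < R) →
  ∑ xs (λ x → b ^ e x) ≡ horner b (λ r → count (λ x → e x ≡ᵇ r) xs) R
∑-pow≡horner b R [] e e<R = sym (horner-zero b R)
∑-pow≡horner b R (x ∷ xs) e e<R = begin
  b ^ e x + ∑ xs (λ x → b ^ e x)
    ≡⟨ cong₂ _+_ (sym (horner-indicator b R (e x) (e<R x (here refl))))
                 (∑-pow≡horner b R xs e (λ y y∈ → e<R y (there y∈))) ⟩
  horner b (λ r → 𝟙 (e x ≡ᵇ r)) R + horner b (λ r → count (λ x → e x ≡ᵇ r) xs) R
    ≡⟨ sym (horner-+ b R _ _) ⟩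
  horner b (λ r → count (λ x → e x ≡ᵇ r) (x ∷ xs)) R ∎
  where open ≡-Reasoning

digit-injective : ∀ b {c c′} x x′ .{{_ : NonZero b}} → c < b → c′ < b → c + b * x ≡ c′ + b * x′ → c ≡ c′ × x ≡ x′
digit-injective b {c} {c′} x x′ c<b c′<b eq =
  c≡c′ , *-cancelˡ-≡ x x′ b (+-cancelˡ-≡ c′ _ _ (subst (λ t → t + b * x ≡ c′ + b * x′) c≡c′ eq))
  where
  open ≡-Reasoning
  c≡c′ : c ≡ c′
  c≡c′ = begin
    c                  ≡⟨ sym (m<n⇒m%n≡m c<b) ⟩
    c % b              ≡⟨ sym ([m+kn]%n≡m%n c x b) ⟩
    (c + x * b) % b    ≡⟨ cong (λ t → (c + t) % b) (*-comm x b) ⟩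
    (c + b * x) % b    ≡⟨ cong (_% b) eq ⟩
    (c′ + b * x′) % b  ≡⟨ cong (λ t → (c′ + t) % b) (*-comm b x′) ⟩
    (c′ + x′ * b) % b  ≡⟨ [m+kn]%n≡m%n c′ x′ b ⟩
    c′ % b             ≡⟨ m<n⇒m%n≡m c′<b ⟩
    c′                 ∎

horner-injective : ∀ b R (a a′ : ℕ → ℕ) .{{_ : NonZero b}} → (∀ r → a r < b) → (∀ r → a′ r < b) →
  horner b a R ≡ horner b a′ R → ∀ r → r < R → a r ≡ a′ r
horner-injective b (suc R) a a′ a<b a′<b eq r r<R
  with digit-injective b _ _ (a<b 0) (a′<b 0) eq
horner-injective b (suc R) a a′ a<b a′<b eq zero _ | a0≡a′0 , _ = a0≡a′0
horner-injective b (suc R) a a′ a<b a′<b eq (suc r) (s≤s r<R) | _ , rest =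
  horner-injective b R (λ r → a (suc r)) (λ r → a′ (suc r)) (λ r → a<b (suc r)) (λ r → a′<b (suc r)) rest r r<R

-- Subsets as bit lists

ones : List Bool → ℕ
ones = count (λ b → b)

bitLists : ℕ → List (List Bool)
bitLists zero = [] ∷ []
bitLists (suc n) = map (false ∷_) (bitLists n) ++ map (true ∷_) (bitLists n)

-- positions of bs past the end of os are not checked
_⊆ᵇ_ : List Bool → List Bool → Bool
[] ⊆ᵇ os = true
(b ∷ bs) ⊆ᵇ [] = true
(false ∷ bs) ⊆ᵇ (o ∷ os) = bs ⊆ᵇ os
(true ∷ bs) ⊆ᵇ (o ∷ os) = o ∧ (bs ⊆ᵇ os)

nthᵇ : List Bool → ℕ → Bool
nthᵇ [] j = false
nthᵇ (b ∷ bs) zero = b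
nthᵇ (b ∷ bs) (suc j) = nthᵇ bs j

∑-subsets : ∀ x (os : List Bool) →
  ∑ (bitLists (length os)) (λ bs → 𝟙 (bs ⊆ᵇ os) * x ^ ones bs) ≡ suc x ^ ones os
∑-subsets x [] = refl
∑-subsets x (o ∷ os) = begin
  ∑ (map (false ∷_) Bs ++ map (true ∷_) Bs) (λ bs → 𝟙 (bs ⊆ᵇ (o ∷ os)) * x ^ ones bs)
    ≡⟨ ∑-++ (map (false ∷_) Bs) _ _ ⟩
  ∑ (map (false ∷_) Bs) _ + ∑ (map (true ∷_) Bs) _
    ≡⟨ cong₂ _+_ (∑-map Bs _ _) (∑-map Bs _ _) ⟩
  S + ∑ Bs (λ bs → 𝟙 (o ∧ (bs ⊆ᵇ os)) * (x * x ^ ones bs))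
    ≡⟨ cong (S +_) (with-head o) ⟩
  S + 𝟙 o * (x * S)
    ≡⟨ cong (λ s → s + 𝟙 o * (x * s)) (∑-subsets x os) ⟩
  suc x ^ ones os + 𝟙 o * (x * suc x ^ ones os)
    ≡⟨ split o ⟩
  suc x ^ (𝟙 o + ones os) ∎
  where
  open ≡-Reasoning
  Bs = bitLists (length os)
  S = ∑ Bs (λ bs → 𝟙 (bs ⊆ᵇ os) * x ^ ones bs)
  with-head : ∀ o → ∑ Bs (λ bs → 𝟙 (o ∧ (bs ⊆ᵇ os)) * (x * x ^ ones bs)) ≡ 𝟙 o * (x * S)
  with-head false = ∑-zero Bs
  with-head true = trans (∑-cong Bs (λ bs _ → *-assoc-swap (𝟙 (bs ⊆ᵇ os)) x (x ^ ones bs)))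
                         (trans (∑-*ˡ Bs x _) (sym (+-identityʳ (x * S))))
    where
    *-assoc-swap : ∀ a b c → a * (b * c) ≡ b * (a * c)
    *-assoc-swap a b c = trans (sym (*-assoc a b c)) (trans (cong (_* c) (*-comm a b)) (*-assoc b a c))
  split : ∀ o → suc x ^ ones os + 𝟙 o * (x * suc x ^ ones os) ≡ suc x ^ (𝟙 o + ones os)
  split false = +-identityʳ _
  split true = cong (suc x ^ ones os +_) (+-identityʳ _)

⊆ᵇ⇔ : ∀ bs os → T (bs ⊆ᵇ os) ⇔ (∀ j → j < length os → T (nthᵇ bs j) → T (nthᵇ os j))
⊆ᵇ⇔ bs os = mk⇔ (to bs os) (from bs os)
  where
  to : ∀ bs os → T (bs ⊆ᵇ os) → ∀ j → j < length os → T (nthᵇ bs j) → T (nthᵇ os j)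
  to (false ∷ bs) (o ∷ os) ⊆ (suc j) (s≤s j<) bj = to bs os ⊆ j j< bj
  to (true ∷ bs) (true ∷ os) ⊆ zero _ _ = _
  to (true ∷ bs) (true ∷ os) ⊆ (suc j) (s≤s j<) bj = to bs os ⊆ j j< bj
  from : ∀ bs os → (∀ j → j < length os → T (nthᵇ bs j) → T (nthᵇ os j)) → T (bs ⊆ᵇ os)
  from [] os _ = _
  from (b ∷ bs) [] _ = _
  from (false ∷ bs) (o ∷ os) ⊆ = from bs os (λ j j< → ⊆ (suc j) (s≤s j<))
  from (true ∷ bs) (o ∷ os) ⊆ = Equivalence.from T-∧ (⊆ zero (s≤s z≤n) _ , from bs os (λ j j< → ⊆ (suc j) (s≤s j<)))

at-fromℕ< : (π : Permutation′ d) {a : ℕ} (a< : a < d) → at π a ≡ toℕ (π ⟨$⟩ʳ fromℕ< a<)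
at-fromℕ< {d} π {a} a< with a <? d
... | yes _ = refl
... | no a≮ = ⊥-elim (a≮ a<)

at-< : (π : Permutation′ d) {a : ℕ} → a < d → at π a < d
at-< π a< = subst (_< _) (sym (at-fromℕ< π a<)) (toℕ<n _)

fromℕ<-at : (π : Permutation′ d) {a : ℕ} (a< : a < d) → fromℕ< (at-< π a<) ≡ π ⟨$⟩ʳ fromℕ< a<
fromℕ<-at π a< = toℕ-injective (trans (toℕ-fromℕ< _) (at-fromℕ< π a<))

at-∘ₚ : (π ρ : Permutation′ d) {a : ℕ} (a< : a < d) → at (π ∘ₚ ρ) a ≡ at ρ (at π a)
at-∘ₚ π ρ a< = begin
  at (π ∘ₚ ρ) _                         ≡⟨ at-fromℕ< (π ∘ₚ ρ) a< ⟩
  toℕ (ρ ⟨$⟩ʳ (π ⟨$⟩ʳ fromℕ< a<))       ≡⟨ cong (λ i → toℕ (ρ ⟨$⟩ʳ i)) (sym (fromℕ<-at π a<)) ⟩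
  toℕ (ρ ⟨$⟩ʳ fromℕ< (at-< π a<))       ≡⟨ sym (at-fromℕ< ρ (at-< π a<)) ⟩
  at ρ (at π _)                         ∎
  where open ≡-Reasoning

at-flip : (π : Permutation′ d) {a : ℕ} → a < d → at (flip π) (at π a) ≡ a
at-flip π {a} a< = begin
  at (flip π) (at π a)                       ≡⟨ at-fromℕ< (flip π) (at-< π a<) ⟩
  toℕ (π ⟨$⟩ˡ fromℕ< (at-< π a<))            ≡⟨ cong (λ i → toℕ (π ⟨$⟩ˡ i)) (fromℕ<-at π a<) ⟩
  toℕ (π ⟨$⟩ˡ (π ⟨$⟩ʳ fromℕ< a<))            ≡⟨ cong toℕ (inverseˡ π) ⟩
  toℕ (fromℕ< a<)                            ≡⟨ toℕ-fromℕ< a< ⟩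
  a                                          ∎
  where open ≡-Reasoning

flip-at : (π : Permutation′ d) {a : ℕ} → a < d → at π (at (flip π) a) ≡ a
flip-at π = at-flip (flip π)

at-injective : (π : Permutation′ d) {a b : ℕ} → a < d → b < d → at π a ≡ at π b → a ≡ b
at-injective π {a} {b} a< b< eq = begin
  a                      ≡⟨ sym (at-flip π a<) ⟩
  at (flip π) (at π a)   ≡⟨ cong (at (flip π)) eq ⟩
  at (flip π) (at π b)   ≡⟨ at-flip π b< ⟩
  b                      ∎
  where open ≡-Reasoning

relabel : Permutation′ d → Permutation′ d → Permutation′ d
relabel v w = w ∘ₚ flip v

at-relabel : (v w : Permutation′ d) {q : ℕ} → q < d → at v (at (relabel v w) q) ≡ at w q
at-relabel v w q< = trans (cong (at v) (at-∘ₚ w (flip v) q<)) (flip-at v (at-< w q<))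

relabel-inverse : (v w : Permutation′ d) {q : ℕ} → q < d → at (relabel v w) (at (relabel w v) q) ≡ q
relabel-inverse v w {q} q< = begin
  at (relabel v w) (at (relabel w v) q)        ≡⟨ at-∘ₚ w (flip v) (at-< (relabel w v) q<) ⟩
  at (flip v) (at w (at (relabel w v) q))      ≡⟨ cong (at (flip v)) (at-relabel w v q<) ⟩
  at (flip v) (at v q)                         ≡⟨ at-flip v q< ⟩
  q                                            ∎
  where open ≡-Reasoning

SameOrder : ℕ → ℕ → ℕ → ℕ → Set
SameOrder x y x′ y′ = ((x < y) ⇔ (x′ < y′)) × ((x ≡ y) ⇔ (x′ ≡ y′))

SameOrder-resp : ∀ {x y x′ y′ x₁ y₁ x₁′ y₁′} → x ≡ x₁ → y ≡ y₁ → x′ ≡ x₁′ → y′ ≡ y₁′ →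
  SameOrder x y x′ y′ → SameOrder x₁ y₁ x₁′ y₁′
SameOrder-resp refl refl refl refl o = o

SameOrder-trans : ∀ {x y x′ y′ x″ y″} → SameOrder x y x′ y′ → SameOrder x′ y′ x″ y″ → SameOrder x y x″ y″
SameOrder-trans (<⇔ , ≡⇔) (<⇔′ , ≡⇔′) = <⇔′ ⇔-∘ <⇔ , ≡⇔′ ⇔-∘ ≡⇔

SameOrder-sym : ∀ {x y x′ y′} → SameOrder x y x′ y′ → SameOrder x′ y′ x y
SameOrder-sym (<⇔ , ≡⇔) = ⇔-sym <⇔ , ⇔-sym ≡⇔

OccursAt : Permutation′ d → (ℕ → ℕ) → ℕ → Set
OccursAt {d} v f j = IsoFactors f j (at v) 0 d

T-== : ∀ a b → T (a == b) ⇔ (T a ⇔ T b)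
T-== true true = mk⇔ (λ _ → mk⇔ _ _) _
T-== false false = mk⇔ (λ _ → mk⇔ (λ ()) (λ ())) _
T-== true false = mk⇔ (λ ()) (λ a⇔b → Equivalence.to a⇔b _)
T-== false true = mk⇔ (λ ()) (λ a⇔b → Equivalence.from a⇔b _)

T-injective : ∀ {b c} → T b ⇔ T c → b ≡ c
T-injective {false} {false} _ = refl
T-injective {true} {true} _ = refl
T-injective {false} {true} b⇔c = ⊥-elim (Equivalence.from b⇔c _)
T-injective {true} {false} b⇔c = ⊥-elim (Equivalence.to b⇔c _)

⇔-cong : {P P′ Q Q′ : Set} → P ⇔ P′ → Q ⇔ Q′ → (P ⇔ Q) ⇔ (P′ ⇔ Q′)
⇔-cong P⇔P′ Q⇔Q′ = mk⇔ (λ P⇔Q → Q⇔Q′ ⇔-∘ (P⇔Q ⇔-∘ ⇔-sym P⇔P′))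
                       (λ P′⇔Q′ → ⇔-sym Q⇔Q′ ⇔-∘ (P′⇔Q′ ⇔-∘ P⇔P′))

T-<ᵇ : ∀ m n → T (m <ᵇ n) ⇔ (m < n)
T-<ᵇ m n = mk⇔ (<ᵇ⇒< m n) <⇒<ᵇ

T-≡ᵇ : ∀ m n → T (m ≡ᵇ n) ⇔ (m ≡ n)
T-≡ᵇ m n = mk⇔ (≡ᵇ⇒≡ m n) (≡⇒≡ᵇ m n)

T-allᵇ : {A : Set} (P : A → Bool) (xs : List A) → T (allᵇ P xs) ⇔ (∀ x → x ∈ xs → T (P x))
T-allᵇ P xs = mk⇔ (to xs) (from xs)
  where
  to : ∀ xs → T (allᵇ P xs) → ∀ x → x ∈ xs → T (P x)
  to (y ∷ xs) all x (here refl) = proj₁ (Equivalence.to T-∧ all)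
  to (y ∷ xs) all x (there x∈) = to xs (proj₂ (Equivalence.to T-∧ all)) x x∈
  from : ∀ xs → (∀ x → x ∈ xs → T (P x)) → T (allᵇ P xs)
  from [] _ = _
  from (y ∷ xs) all = Equivalence.from T-∧ (all y (here refl) , from xs (λ x x∈ → all x (there x∈)))

T-orderIsoᵇ : (a b : Fin d → ℕ) → T (orderIsoᵇ a b) ⇔ (∀ p q → SameOrder (a p) (a q) (b p) (b q))
T-orderIsoᵇ {d} a b =
  mk⇔ (λ iso p q → decode p q (Equivalence.to (T-allᵇ compare pairs) iso (p , q) (∈-cartesianProduct⁺ (∈-allFin p) (∈-allFin q))))
      (λ iso → Equivalence.from (T-allᵇ compare pairs) (λ (p , q) _ → encode p q (iso p q)))
  where
  pairs = cartesianProduct (allFin d) (allFin d)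
  compare : Fin d × Fin d → Bool
  compare (p , q) = ((a p <ᵇ a q) == (b p <ᵇ b q)) ∧ ((a p ≡ᵇ a q) == (b p ≡ᵇ b q))
  <⇔ : ∀ p q → T ((a p <ᵇ a q) == (b p <ᵇ b q)) ⇔ ((a p < a q) ⇔ (b p < b q))
  <⇔ p q = ⇔-cong (T-<ᵇ _ _) (T-<ᵇ _ _) ⇔-∘ T-== _ _
  ≡⇔ : ∀ p q → T ((a p ≡ᵇ a q) == (b p ≡ᵇ b q)) ⇔ ((a p ≡ a q) ⇔ (b p ≡ b q))
  ≡⇔ p q = ⇔-cong (T-≡ᵇ _ _) (T-≡ᵇ _ _) ⇔-∘ T-== _ _
  decode : ∀ p q → T (compare (p , q)) → SameOrder (a p) (a q) (b p) (b q)
  decode p q c with Equivalence.to T-∧ c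
  ... | c< , c≡ = Equivalence.to (<⇔ p q) c< , Equivalence.to (≡⇔ p q) c≡
  encode : ∀ p q → SameOrder (a p) (a q) (b p) (b q) → T (compare (p , q))
  encode p q (o< , o≡) = Equivalence.from T-∧ (Equivalence.from (<⇔ p q) o< , Equivalence.from (≡⇔ p q) o≡)

-- junk value 0 past the end of the list
nth : List ℕ → ℕ → ℕ
nth [] j = 0
nth (x ∷ xs) zero = x
nth (x ∷ xs) (suc j) = nth xs j

nth-drop : ∀ xs j a → nth (drop j xs) a ≡ nth xs (j + a)
nth-drop xs zero a = refl
nth-drop [] (suc j) a = refl
nth-drop (x ∷ xs) (suc j) a = nth-drop xs j a

window-just : ∀ d xs → d ≤ length xs → Σ (Vec ℕ d) λ ys → window d xs ≡ just ys × (∀ a → lookup ys a ≡ nth xs (toℕ a))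
window-just zero xs _ = [] , refl , λ ()
window-just (suc d) (x ∷ xs) (s≤s d≤) with window d xs | window-just d xs d≤
... | just ys | .ys , refl , lookup-ys = x ∷ ys , refl , λ { fzero → refl ; (fsuc a) → lookup-ys a }
... | nothing | _ , () , _

window-nothing : ∀ d xs → length xs < d → window d xs ≡ nothing
window-nothing (suc d) [] _ = refl
window-nothing (suc d) (x ∷ xs) (s≤s <d) rewrite window-nothing d xs <d = refl

at-toℕ : ∀ (v : Permutation′ d) (p : Fin d) → at v (toℕ p) ≡ letter v p
at-toℕ v p = trans (at-fromℕ< v (toℕ<n p)) (cong (letter v) (fromℕ<-toℕ p (toℕ<n p)))

T-occursHere : ∀ (v : Permutation′ d) xs → T (occursHere v xs) ⇔ (d ≤ length xs × OccursAt v (nth xs) 0)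
T-occursHere {d} v xs with d ≤? length xs
... | no d≰ rewrite window-nothing d xs (≰⇒> d≰) = mk⇔ (λ ()) (λ (d≤ , _) → ⊥-elim (d≰ d≤))
... | yes d≤ with window d xs | window-just d xs d≤
... | nothing | _ , () , _
... | just ys | .ys , refl , lookup-ys =
  mk⇔ (λ occ → d≤ , fin⇒ℕ (Equivalence.to (T-orderIsoᵇ (lookup ys) (letter v)) occ))
      (λ (_ , occ) → Equivalence.from (T-orderIsoᵇ (lookup ys) (letter v)) (ℕ⇒fin occ))
  where
  lookup-fromℕ< : ∀ {a} (a< : a < d) → lookup ys (fromℕ< a<) ≡ nth xs a
  lookup-fromℕ< a< = trans (lookup-ys (fromℕ< a<)) (cong (nth xs) (toℕ-fromℕ< a<))
  fin⇒ℕ : (∀ p q → SameOrder (lookup ys p) (lookup ys q) (letter v p) (letter v q)) → OccursAt v (nth xs) 0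
  fin⇒ℕ iso a b a< b< = SameOrder-resp (lookup-fromℕ< a<) (lookup-fromℕ< b<) (sym (at-fromℕ< v a<)) (sym (at-fromℕ< v b<))
    (iso (fromℕ< a<) (fromℕ< b<))
  ℕ⇒fin : OccursAt v (nth xs) 0 → ∀ p q → SameOrder (lookup ys p) (lookup ys q) (letter v p) (letter v q)
  ℕ⇒fin occ p q = SameOrder-resp (sym (lookup-ys p)) (sym (lookup-ys q)) (at-toℕ v p) (at-toℕ v q)
    (occ (toℕ p) (toℕ q) (toℕ<n p) (toℕ<n q))

OccursAt-shift : ∀ (v : Permutation′ d) xs j → OccursAt v (nth (drop j xs)) 0 ⇔ OccursAt v (nth xs) j
OccursAt-shift v xs j =
  mk⇔ (λ occ a b a< b< → SameOrder-resp (nth-drop xs j a) (nth-drop xs j b) refl refl (occ a b a< b<))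
      (λ occ a b a< b< → SameOrder-resp (sym (nth-drop xs j a)) (sym (nth-drop xs j b)) refl refl (occ a b a< b<))

T-occursHere-drop : ∀ (v : Permutation′ d) xs j → j ≤ length xs →
  T (occursHere v (drop j xs)) ⇔ (j + d ≤ length xs × OccursAt v (nth xs) j)
T-occursHere-drop {d} v xs j j≤ = mk⇔
  (λ occ → let d≤ , o = Equivalence.to (T-occursHere v (drop j xs)) occ in
     fits⇒ (subst (d ≤_) (length-drop j xs) d≤) , Equivalence.to (OccursAt-shift v xs j) o)
  (λ (j+d≤ , o) → Equivalence.from (T-occursHere v (drop j xs))
     (subst (d ≤_) (sym (length-drop j xs)) (⇒fits j+d≤) , Equivalence.from (OccursAt-shift v xs j) o))
  where
  fits⇒ : d ≤ length xs ∸ j → j + d ≤ length xs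
  fits⇒ d≤ = subst (_≤ length xs) (+-comm d j) (m≤o∸n⇒m+n≤o d j≤ d≤)
  ⇒fits : j + d ≤ length xs → d ≤ length xs ∸ j
  ⇒fits j+d≤ = m+n≤o⇒m≤o∸n d (subst (_≤ length xs) (+-comm j d) j+d≤)

occurrences : Permutation′ d → List ℕ → List Bool
occurrences v [] = []
occurrences v (x ∷ xs) = occursHere v (x ∷ xs) ∷ occurrences v xs

conList≡ones : ∀ (v : Permutation′ d) xs → conList v xs ≡ ones (occurrences v xs)
conList≡ones v [] = refl
conList≡ones v (x ∷ xs) with occursHere v (x ∷ xs)
... | true = cong suc (conList≡ones v xs)
... | false = conList≡ones v xs

length-occurrences : ∀ (v : Permutation′ d) xs → length (occurrences v xs) ≡ length xs
length-occurrences v [] = refl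
length-occurrences v (x ∷ xs) = cong suc (length-occurrences v xs)

nthᵇ-occurrences : ∀ (v : Permutation′ d) xs j → j < length xs → nthᵇ (occurrences v xs) j ≡ occursHere v (drop j xs)
nthᵇ-occurrences v (x ∷ xs) zero _ = refl
nthᵇ-occurrences v (x ∷ xs) (suc j) (s≤s j<) = nthᵇ-occurrences v xs j j<

record PermutationBelow (i : ℕ) (τ : ℕ → ℕ) : Set where
  field
    τ⁻¹ : ℕ → ℕ
    τ-< : ∀ {q} → q < i → τ q < i
    τ⁻¹-< : ∀ {q} → q < i → τ⁻¹ q < i
    τ⁻¹∘τ : ∀ {q} → q < i → τ⁻¹ (τ q) ≡ q
    τ∘τ⁻¹ : ∀ {q} → q < i → τ (τ⁻¹ q) ≡ q

open PermutationBelow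

count-reindex : ∀ {i τ} → PermutationBelow i τ → (P : ℕ → Bool) → count (λ q → P (τ q)) (upTo i) ≡ count P (upTo i)
count-reindex {i} {τ} perm P = count-bijection (Unique.upTo⁺ i) (Unique.upTo⁺ i) record
  { to = τ
  ; from = τ⁻¹ perm
  ; to-∈ = λ q q∈ Pτq → ∈-upTo⁺ (τ-< perm (∈-upTo⁻ q∈)) , Pτq
  ; from-∈ = λ q q∈ Pq →
      ∈-upTo⁺ (τ⁻¹-< perm (∈-upTo⁻ q∈)) , subst (λ q → T (P q)) (sym (τ∘τ⁻¹ perm (∈-upTo⁻ q∈))) Pq
  ; from∘to = λ q q∈ _ → τ⁻¹∘τ perm (∈-upTo⁻ q∈)
  ; to∘from = λ q q∈ _ → τ∘τ⁻¹ perm (∈-upTo⁻ q∈)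
  }

rank : (ℕ → ℕ) → ℕ → ℕ → ℕ
rank f i y = count (λ z → f z <ᵇ f y) (upTo i)

rank-< : ∀ f i {y y′} → y < i → f y < f y′ → rank f i y < rank f i y′
rank-< f i {y} y< fy<fy′ = count-< (upTo i)
  (λ z _ fz<fy → Equivalence.from (T-<ᵇ _ _) (<-trans (Equivalence.to (T-<ᵇ _ _) fz<fy) fy<fy′))
  (∈-upTo⁺ y<) (λ fy<fy → <-irrefl refl (Equivalence.to (T-<ᵇ (f y) (f y)) fy<fy)) (Equivalence.from (T-<ᵇ _ _) fy<fy′)

rank-reindex : ∀ {i τ τ′} (f : ℕ → ℕ) → PermutationBelow i τ → PermutationBelow i τ′ →
  (∀ {q q′} → q < i → q′ < i → (f (τ q) < f (τ q′)) ⇔ (f (τ′ q) < f (τ′ q′))) →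
  ∀ {q} → q < i → rank f i (τ q) ≡ rank f i (τ′ q)
rank-reindex {i} {τ} {τ′} f perm perm′ same-order {q} q< = begin
  rank f i (τ q)                                  ≡⟨ count-reindex perm _ ⟨
  count (λ z → f (τ z) <ᵇ f (τ q)) (upTo i)
    ≡⟨ ∑-cong (upTo i) (λ z z∈ → cong 𝟙 (T-injective (T-<ᵇ-cong (same-order (∈-upTo⁻ z∈) q<)))) ⟩
  count (λ z → f (τ′ z) <ᵇ f (τ′ q)) (upTo i)    ≡⟨ count-reindex perm′ _ ⟩
  rank f i (τ′ q)                                 ∎
  where
  open ≡-Reasoning
  T-<ᵇ-cong : ∀ {m n m′ n′} → (m < n) ⇔ (m′ < n′) → T (m <ᵇ n) ⇔ T (m′ <ᵇ n′)
  T-<ᵇ-cong {m} {n} {m′} {n′} m<n⇔ = ⇔-sym (T-<ᵇ m′ n′) ⇔-∘ (m<n⇔ ⇔-∘ T-<ᵇ m n)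

-- τ q is recovered from f ∘ τ as the unique position whose f-rank is the rank of q under f ∘ τ.
PermutationBelow-unique : ∀ {i τ τ′} (f : ℕ → ℕ) →
  (∀ {a b} → a < i → b < i → f a ≡ f b → a ≡ b) →
  PermutationBelow i τ → PermutationBelow i τ′ →
  (∀ {q q′} → q < i → q′ < i → (f (τ q) < f (τ q′)) ⇔ (f (τ′ q) < f (τ′ q′))) →
  ∀ {q} → q < i → τ q ≡ τ′ q
PermutationBelow-unique {i} {τ} {τ′} f f-injective perm perm′ same-order {q} q<
  with <-cmp (f (τ q)) (f (τ′ q))
... | tri< lt _ _ = ⊥-elim (<-irrefl (rank-reindex f perm perm′ same-order q<) (rank-< f i (τ-< perm q<) lt))
... | tri≈ _ eq _ = f-injective (τ-< perm q<) (τ-< perm′ q<) eq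
... | tri> _ _ gt = ⊥-elim (<-irrefl (sym (rank-reindex f perm perm′ same-order q<)) (rank-< f i (τ-< perm′ q<) gt))

-- The relabelling along overlaps

SameLetters : Permutation′ d → Permutation′ d → ℕ → ℕ → Set
SameLetters v w lo hi = ∀ x → LetterSet v lo hi x ⇔ LetterSet w lo hi x

SameLetters-sym : ∀ (v w : Permutation′ d) {lo hi} → SameLetters v w lo hi → SameLetters w v lo hi
SameLetters-sym v w same x = ⇔-sym (same x)

relabel-reflects-block : ∀ (v w : Permutation′ d) {lo hi q} → SameLetters v w lo hi → hi ≤ d → q < d →
  lo ≤ at (relabel v w) q → at (relabel v w) q < hi → lo ≤ q × q < hi
relabel-reflects-block v w {q = q} same hi≤ q< lo≤σq σq<hi
  with Equivalence.to (same _) (at (relabel v w) q , lo≤σq , σq<hi , refl)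
... | p , lo≤p , p<hi , wp≡ with at-injective w (<-≤-trans p<hi hi≤) q< (trans wp≡ (at-relabel v w q<))
... | refl = lo≤p , p<hi

relabel-below : ∀ (v w : Permutation′ d) {i q} → SameLetters v w i d → q < i → i ≤ d → at (relabel v w) q < i
relabel-below v w {i} same q<i i≤d with i ≤? at (relabel v w) _
... | no σq≱i = ≰⇒> σq≱i
... | yes i≤σq = ⊥-elim (<⇒≱ q<i (proj₁ (relabel-reflects-block v w same ≤-refl (<-≤-trans q<i i≤d) i≤σq
                                                              (at-< (relabel v w) (<-≤-trans q<i i≤d)))))

relabel-above : ∀ (v w : Permutation′ d) {s q} → SameLetters v w 0 s → s ≤ d → s ≤ q → q < d → s ≤ at (relabel v w) q
relabel-above v w same s≤d s≤q q<d with _ ≤? at (relabel v w) _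
... | yes s≤σq = s≤σq
... | no s≰σq = ⊥-elim (<⇒≱ (proj₂ (relabel-reflects-block v w same s≤d q<d z≤n (≰⇒> s≰σq))) s≤q)

relabel-PermutationBelow : ∀ (v w : Permutation′ d) {i} → SameLetters v w i d → i ≤ d →
  PermutationBelow i (at (relabel v w))
relabel-PermutationBelow v w same i≤d = record
  { τ⁻¹ = at (relabel w v)
  ; τ-< = λ q< → relabel-below v w same q< i≤d
  ; τ⁻¹-< = λ q< → relabel-below w v (SameLetters-sym v w same) q< i≤d
  ; τ⁻¹∘τ = λ q< → relabel-inverse w v (<-≤-trans q< i≤d)
  ; τ∘τ⁻¹ = λ q< → relabel-inverse v w (<-≤-trans q< i≤d)
  }

+<-of-+≡ : ∀ {s i d q} → s + i ≡ d → q < i → s + q < d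
+<-of-+≡ {s} s+i≡d q<i = subst (_ <_) s+i≡d (+-monoʳ-< s q<i)

shiftedRelabel : Permutation′ d → Permutation′ d → ℕ → ℕ → ℕ
shiftedRelabel v w s q = at (relabel v w) (s + q) ∸ s

module _ (v w : Permutation′ d) {s i : ℕ} (s+i≡d : s + i ≡ d) (same : SameLetters v w 0 s) where

  s≤relabel : ∀ {q} → q < i → s ≤ at (relabel v w) (s + q)
  s≤relabel {q} q<i = relabel-above v w same (subst (s ≤_) s+i≡d (m≤m+n s i)) (m≤m+n s q) (+<-of-+≡ s+i≡d q<i)

  shiftedRelabel-unshift : ∀ {q} → q < i → s + shiftedRelabel v w s q ≡ at (relabel v w) (s + q)
  shiftedRelabel-unshift q<i = m+[n∸m]≡n (s≤relabel q<i)

  shiftedRelabel-< : ∀ {q} → q < i → shiftedRelabel v w s q < i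
  shiftedRelabel-< {q} q<i = +-cancelˡ-< s _ i (begin-strict
    s + shiftedRelabel v w s q   ≡⟨ shiftedRelabel-unshift q<i ⟩
    at (relabel v w) (s + q)     <⟨ at-< (relabel v w) (+<-of-+≡ s+i≡d q<i) ⟩
    d                            ≡⟨ s+i≡d ⟨
    s + i                        ∎)
    where open ≤-Reasoning

  shiftedRelabel-inverse : ∀ {q} → q < i → shiftedRelabel w v s (shiftedRelabel v w s q) ≡ q
  shiftedRelabel-inverse {q} q<i = begin
    at (relabel w v) (s + shiftedRelabel v w s q) ∸ s   ≡⟨ cong (λ x → at (relabel w v) x ∸ s) (shiftedRelabel-unshift q<i) ⟩
    at (relabel w v) (at (relabel v w) (s + q)) ∸ s     ≡⟨ cong (_∸ s) (relabel-inverse w v (+<-of-+≡ s+i≡d q<i)) ⟩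
    s + q ∸ s                                           ≡⟨ m+n∸m≡n s q ⟩
    q                                                   ∎
    where open ≡-Reasoning

shiftedRelabel-PermutationBelow : ∀ (v w : Permutation′ d) s {i} → s + i ≡ d → SameLetters v w 0 s →
  PermutationBelow i (shiftedRelabel v w s)
shiftedRelabel-PermutationBelow v w s s+i≡d same = record
  { τ⁻¹ = shiftedRelabel w v s
  ; τ-< = shiftedRelabel-< v w s+i≡d same
  ; τ⁻¹-< = shiftedRelabel-< w v s+i≡d (SameLetters-sym v w same)
  ; τ⁻¹∘τ = shiftedRelabel-inverse v w s+i≡d same
  ; τ∘τ⁻¹ = shiftedRelabel-inverse w v s+i≡d (SameLetters-sym v w same)
  }

record CompatibleAt (v w : Permutation′ d) (i : ℕ) : Set where
  field
    w-overlaps : InOverlap w i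
    same-prefix : SameLetters v w 0 (d ∸ i)
    same-suffix : SameLetters v w i d

Compatible : Permutation′ d → Permutation′ d → Set
Compatible v w = ∀ i → InOverlap v i → CompatibleAt v w i

relabel-shift : ∀ (v w : Permutation′ d) {i} → InOverlap v i → CompatibleAt v w i →
  ∀ {q} → q < i → at (relabel v w) (d ∸ i + q) ≡ d ∸ i + at (relabel v w) q
relabel-shift {d} v w {i} (_ , i<d , v-overlap) compat {q} q<i = begin
  at (relabel v w) (s + q)          ≡⟨ shiftedRelabel-unshift v w s+i≡d same-prefix q<i ⟨
  s + shiftedRelabel v w s q        ≡⟨ cong (s +_) shifted≡relabel ⟩
  s + at (relabel v w) q            ∎
  where
  open ≡-Reasoning
  open CompatibleAt compat
  s = d ∸ i
  s+i≡d : s + i ≡ d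
  s+i≡d = m∸n+n≡m (<⇒≤ i<d)
  relabel-at-s+ : ∀ {q} → q < i → at v (s + shiftedRelabel v w s q) ≡ at w (s + q)
  relabel-at-s+ q<i = trans (cong (at v) (shiftedRelabel-unshift v w s+i≡d same-prefix q<i))
                            (at-relabel v w (+<-of-+≡ s+i≡d q<i))
  same-order : ∀ {q q′} → q < i → q′ < i →
    (at v (shiftedRelabel v w s q) < at v (shiftedRelabel v w s q′)) ⇔ (at v (at (relabel v w) q) < at v (at (relabel v w) q′))
  same-order {q} {q′} q<i q′<i = proj₁ (SameOrder-trans
    (v-overlap _ _ (shiftedRelabel-< v w s+i≡d same-prefix q<i) (shiftedRelabel-< v w s+i≡d same-prefix q′<i))
    (SameOrder-resp (sym (relabel-at-s+ q<i)) (sym (relabel-at-s+ q′<i))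
                    (sym (at-relabel v w (<-trans q<i i<d))) (sym (at-relabel v w (<-trans q′<i i<d)))
                    (SameOrder-sym (proj₂ (proj₂ w-overlaps) q q′ q<i q′<i))))
  shifted≡relabel : shiftedRelabel v w s q ≡ at (relabel v w) q
  shifted≡relabel = PermutationBelow-unique (at v)
    (λ a<i b<i → at-injective v (<-trans a<i i<d) (<-trans b<i i<d))
    (shiftedRelabel-PermutationBelow v w s s+i≡d same-prefix)
    (relabel-PermutationBelow v w same-suffix (<⇒≤ i<d))
    same-order q<i

-- Rearranging marked occurrences

+∸-< : ∀ {s d} a → s < d → s + a < d → a < d ∸ s
+∸-< {s} {d} a s<d s+a<d = m+n≤o⇒m≤o∸n (suc a) (subst (_≤ d) (cong suc (+-comm s a)) s+a<d)

occurrences-overlap : ∀ (v : Permutation′ d) U {p s} → OccursAt v U p → OccursAt v U (p + s) → 0 < s → s < d →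
  InOverlap v (d ∸ s)
occurrences-overlap {d} v U {p} {s} occ occ′ 0<s s<d =
  m<n⇒0<n∸m s<d , ∸-monoʳ-< 0<s (<⇒≤ s<d) ,
  subst (λ t → IsoFactors (at v) 0 (at v) t (d ∸ s)) (sym (m∸[m∸n]≡n (<⇒≤ s<d))) iso
  where
  s+< : ∀ {a} → a < d ∸ s → s + a < d
  s+< {a} a< = subst (s + a <_) (m+[n∸m]≡n (<⇒≤ s<d)) (+-monoʳ-< s a<)
  iso : IsoFactors (at v) 0 (at v) s (d ∸ s)
  iso a b a< b< = SameOrder-trans (SameOrder-sym
    (SameOrder-resp (cong U (+-assoc p s a)) (cong U (+-assoc p s b)) refl refl
      (occ′ a b (<-≤-trans a< (m∸n≤m d s)) (<-≤-trans b< (m∸n≤m d s)))))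
    (occ (s + a) (s + b) (s+< a<) (s+< b<))

Covers : (ℕ → Bool) → ℕ → ℕ → ℕ → ℕ → Set
Covers M n d x p = T (M p) × x ∸ p < d × p + d ≤ n

cover? : ∀ M n d x → Dec (∃ λ p → p < suc x × Covers M n d x p)
cover? M n d x = anyUpTo? (λ p → T? (M p) ×-dec (x ∸ p <? d ×-dec p + d ≤? n)) (suc x)

-- When marked factors overlap, the choice of p does not matter (relabel-agrees).
rearrange : Permutation′ d → ℕ → (ℕ → Bool) → ℕ → ℕ
rearrange {d} σ n M x with cover? M n d x
... | yes (p , _) = p + at σ (x ∸ p)
... | no _ = x

rearrange-< : ∀ (σ : Permutation′ d) {n M x} → x < n → rearrange σ n M x < n
rearrange-< {d} σ {n} {M} {x} x<n with cover? M n d x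
... | yes (p , _ , _ , x∸p<d , p+d≤n) = <-≤-trans (+-monoʳ-< p (at-< σ x∸p<d)) p+d≤n
... | no _ = x<n

rearrange-uncovered : ∀ (σ : Permutation′ d) {n M x} → ¬ (∃ λ p → p < suc x × Covers M n d x p) → rearrange σ n M x ≡ x
rearrange-uncovered {d} σ {n} {M} {x} no-cover with cover? M n d x
... | yes cover = ⊥-elim (no-cover cover)
... | no _ = refl

MarksOccurrences : Permutation′ d → ℕ → (ℕ → Bool) → (ℕ → ℕ) → Set
MarksOccurrences {d} v n M U = ∀ {j} → j < n → T (M j) → j + d ≤ n × OccursAt v U j

module _ (v w : Permutation′ d) (compatible : Compatible v w) where

  private
    σ = relabel v w

  relabel-shift-occurrences : ∀ U {p} s {a} → OccursAt v U p → OccursAt v U (p + s) → s + a < d →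
    p + at σ (s + a) ≡ p + s + at σ a
  relabel-shift-occurrences U {p} zero _ _ _ = cong (_+ at σ _) (sym (+-identityʳ p))
  relabel-shift-occurrences U {p} s@(suc _) {a} occ occ′ s+a<d = begin
    p + at σ (s + a)              ≡⟨ cong (λ t → p + at σ (t + a)) (sym d∸i≡s) ⟩
    p + at σ (d ∸ i + a)          ≡⟨ cong (p +_) (relabel-shift v w overlaps (compatible i overlaps) a<i) ⟩
    p + (d ∸ i + at σ a)          ≡⟨ cong (λ t → p + (t + at σ a)) d∸i≡s ⟩
    p + (s + at σ a)              ≡⟨ +-assoc p s (at σ a) ⟨
    p + s + at σ a                ∎
    where
    open ≡-Reasoning
    s<d = ≤-<-trans (m≤m+n s a) s+a<d
    i = d ∸ s
    d∸i≡s : d ∸ i ≡ s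
    d∸i≡s = m∸[m∸n]≡n (<⇒≤ s<d)
    overlaps = occurrences-overlap v U occ occ′ (s≤s z≤n) s<d
    a<i : a < i
    a<i = +∸-< a s<d s+a<d

  relabel-agrees-≤ : ∀ U {q p b a} → OccursAt v U q → OccursAt v U p → b < d → q ≤ p → q + b ≡ p + a →
    q + at σ b ≡ p + at σ a
  relabel-agrees-≤ U {q} {p} {b} {a} occ-q occ-p b<d q≤p q+b≡p+a = begin
    q + at σ b            ≡⟨ cong (λ t → q + at σ t) b≡s+a ⟩
    q + at σ (s + a)      ≡⟨ relabel-shift-occurrences U s occ-q (subst (OccursAt v U) (sym q+s≡p) occ-p) (subst (_< d) b≡s+a b<d) ⟩
    q + s + at σ a        ≡⟨ cong (_+ at σ a) q+s≡p ⟩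
    p + at σ a            ∎
    where
    open ≡-Reasoning
    s = p ∸ q
    q+s≡p : q + s ≡ p
    q+s≡p = m+[n∸m]≡n q≤p
    b≡s+a : b ≡ s + a
    b≡s+a = +-cancelˡ-≡ q b (s + a) (trans q+b≡p+a (trans (cong (_+ a) (sym q+s≡p)) (+-assoc q s a)))

  relabel-agrees : ∀ U {q p b a} → OccursAt v U q → OccursAt v U p → b < d → a < d → q + b ≡ p + a →
    q + at σ b ≡ p + at σ a
  relabel-agrees U {q} {p} occ-q occ-p b<d a<d q+b≡p+a with ≤-total q p
  ... | inj₁ q≤p = relabel-agrees-≤ U occ-q occ-p b<d q≤p q+b≡p+a
  ... | inj₂ p≤q = sym (relabel-agrees-≤ U occ-p occ-q a<d p≤q (sym q+b≡p+a))

  rearrange-mark : ∀ {n M U} → MarksOccurrences v n M U → ∀ {p a} → p < n → T (M p) → a < d →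
    rearrange σ n M (p + a) ≡ p + at σ a
  rearrange-mark {n} {M} {U} marks {p} {a} p<n Mp a<d with cover? M n d (p + a)
  ... | yes (q , q<1+x , Mq , x∸q<d , _) = relabel-agrees U (proj₂ (marks (≤-<-trans q≤x p+a<n) Mq)) (proj₂ (marks p<n Mp))
                                               x∸q<d a<d (m+[n∸m]≡n q≤x)
    where
    q≤x = s≤s⁻¹ q<1+x
    p+a<n = <-≤-trans (+-monoʳ-< p a<d) (proj₁ (marks p<n Mp))
  ... | no no-cover = ⊥-elim (no-cover (p , s≤s (m≤m+n p a) , Mp , subst (_< d) (sym (m+n∸m≡n p a)) a<d , proj₁ (marks p<n Mp)))

  rearrange-inverse : ∀ {n M U} → MarksOccurrences v n M U → ∀ {j} → j < n →
    rearrange σ n M (rearrange (relabel w v) n M j) ≡ j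
  rearrange-inverse {n} {M} {U} marks {j} j<n with cover? M n d j
  ... | yes (p , p<1+j , Mp , j∸p<d , _) = begin
    rearrange σ n M (p + at (relabel w v) (j ∸ p))
      ≡⟨ rearrange-mark {U = U} marks (≤-<-trans (s≤s⁻¹ p<1+j) j<n) Mp (at-< (relabel w v) j∸p<d) ⟩
    p + at σ (at (relabel w v) (j ∸ p))               ≡⟨ cong (p +_) (relabel-inverse v w j∸p<d) ⟩
    p + (j ∸ p)                                       ≡⟨ m+[n∸m]≡n (s≤s⁻¹ p<1+j) ⟩
    j                                                 ∎
    where open ≡-Reasoning
  ... | no no-cover = rearrange-uncovered σ no-cover

  MarksOccurrences-rearrange : ∀ {n M U U′} → (∀ {x} → x < n → U′ x ≡ U (rearrange σ n M x)) →
    MarksOccurrences v n M U → MarksOccurrences w n M U′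
  MarksOccurrences-rearrange {n} {M} {U} {U′} U′≡U∘rearrange marks {j} j<n Mj = j+d≤n , occurs
    where
    j+d≤n = proj₁ (marks j<n Mj)
    U′≡U∘relabel : ∀ {a} → a < d → U′ (j + a) ≡ U (j + at σ a)
    U′≡U∘relabel a<d = trans (U′≡U∘rearrange (<-≤-trans (+-monoʳ-< j a<d) j+d≤n)) (cong U (rearrange-mark {U = U} marks j<n Mj a<d))
    occurs : OccursAt w U′ j
    occurs a b a<d b<d = SameOrder-resp (sym (U′≡U∘relabel a<d)) (sym (U′≡U∘relabel b<d)) (at-relabel v w a<d) (at-relabel v w b<d)
      (proj₂ (marks j<n Mj) (at σ a) (at σ b) (at-< σ a<d) (at-< σ b<d))

allWords-suc : ∀ k n → allWords k (suc n) ≡ cartesianProductWith _∷_ (allFin k) (allWords k n)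
allWords-suc k n = go (allFin k)
  where
  go : (as : List (Fin k)) → concat (map (λ a → map (a ∷_) (allWords k n)) as) ≡ cartesianProductWith _∷_ as (allWords k n)
  go [] = refl
  go (a ∷ as) = cong (map (a ∷_) (allWords k n) ++_) (go as)

allWords-unique : ∀ k n → Unique (allWords k n)
allWords-unique k zero = All.[] ∷ []
allWords-unique k (suc n) rewrite allWords-suc k n =
  Unique.cartesianProductWith⁺ _∷_ ∷-injective (Unique.allFin⁺ k) (allWords-unique k n)

∈-allWords : ∀ (u : Word k n) → u ∈ allWords k n
∈-allWords [] = here refl
∈-allWords {k} {suc n} (a ∷ u) rewrite allWords-suc k n = ∈-cartesianProductWith⁺ _∷_ (∈-allFin a) (∈-allWords u)

letters : Word k n → List ℕ
letters u = toList (Vec.map toℕ u)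

length-letters : (u : Word k n) → length (letters u) ≡ n
length-letters [] = refl
length-letters (a ∷ u) = cong suc (length-letters u)

nth-letters : (u : Word k n) (j : Fin n) → nth (letters u) (toℕ j) ≡ toℕ (lookup u j)
nth-letters (a ∷ u) fzero = refl
nth-letters (a ∷ u) (fsuc j) = nth-letters u j

rearrangePosition : Permutation′ d → (ℕ → Bool) → Fin n → Fin n
rearrangePosition σ M j = fromℕ< (rearrange-< σ {M = M} (toℕ<n j))

rearrangeWord : Permutation′ d → (ℕ → Bool) → Word k n → Word k n
rearrangeWord σ M u = tabulate (λ j → lookup u (rearrangePosition σ M j))

nth-rearrangeWord : ∀ (σ : Permutation′ d) M (u : Word k n) {x} → x < n →
  nth (letters (rearrangeWord σ M u)) x ≡ nth (letters u) (rearrange σ n M x)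
nth-rearrangeWord σ M u {x} x<n = begin
  nth (letters (rearrangeWord σ M u)) x                   ≡⟨ cong (nth (letters (rearrangeWord σ M u))) (toℕ-fromℕ< x<n) ⟨
  nth (letters (rearrangeWord σ M u)) (toℕ (fromℕ< x<n))  ≡⟨ nth-letters (rearrangeWord σ M u) (fromℕ< x<n) ⟩
  toℕ (lookup (rearrangeWord σ M u) (fromℕ< x<n))         ≡⟨ cong toℕ (lookup∘tabulate _ (fromℕ< x<n)) ⟩
  toℕ (lookup u (rearrangePosition σ M (fromℕ< x<n)))     ≡⟨ nth-letters u _ ⟨
  nth (letters u) (toℕ (rearrangePosition σ M (fromℕ< x<n)))
    ≡⟨ cong (nth (letters u)) (trans (toℕ-fromℕ< _) (cong (rearrange σ _ M) (toℕ-fromℕ< x<n))) ⟩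
  nth (letters u) (rearrange σ _ M x)                     ∎
  where open ≡-Reasoning

rearrangeWord-inverse : ∀ (v w : Permutation′ d) → Compatible v w → ∀ M (u : Word k n) →
  MarksOccurrences v n M (nth (letters u)) → rearrangeWord (relabel w v) M (rearrangeWord (relabel v w) M u) ≡ u
rearrangeWord-inverse v w compatible M u marks =
  trans (tabulate-cong (λ j → trans (lookup∘tabulate _ (rearrangePosition (relabel w v) M j))
                                    (cong (lookup u) (toℕ-injective (position-inverse j)))))
        (tabulate∘lookup u)
  where
  position-inverse : ∀ j → toℕ (rearrangePosition (relabel v w) M (rearrangePosition (relabel w v) M j)) ≡ toℕ j
  position-inverse j = trans (toℕ-fromℕ< _)
    (trans (cong (rearrange (relabel v w) _ M) (toℕ-fromℕ< _)) (rearrange-inverse v w compatible {U = nth (letters u)} marks (toℕ<n j)))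

T-⊆ᵇ-occurrences : ∀ (v : Permutation′ d) (bs : List Bool) (u : Word k n) →
  T (bs ⊆ᵇ occurrences v (letters u)) ⇔ MarksOccurrences v n (nthᵇ bs) (nth (letters u))
T-⊆ᵇ-occurrences {d} {n = n} v bs u = mk⇔
  (λ ⊆occ {j} j<n bj → from-drop j<n (Equivalence.to (⊆ᵇ⇔ bs occs) ⊆occ j (<-length j<n) bj))
  (λ marks → Equivalence.from (⊆ᵇ⇔ bs occs) (λ j j< bj → to-drop (<-n j<) (marks (<-n j<) bj)))
  where
  xs = letters u
  occs = occurrences v xs
  length-occs : length occs ≡ n
  length-occs = trans (length-occurrences v xs) (length-letters u)
  <-length : ∀ {j} → j < n → j < length occs
  <-length = subst (_ <_) (sym length-occs)
  <-n : ∀ {j} → j < length occs → j < n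
  <-n = subst (_ <_) length-occs
  drop⇔ : ∀ {j} → j < n → T (occursHere v (Data.List.drop j xs)) ⇔ (j + d ≤ length xs × OccursAt v (nth xs) j)
  drop⇔ j<n = T-occursHere-drop v xs _ (subst (_ ≤_) (sym (length-letters u)) (<⇒≤ j<n))
  from-drop : ∀ {j} → j < n → T (nthᵇ occs j) → j + d ≤ n × OccursAt v (nth xs) j
  from-drop {j} j<n occ with Equivalence.to (drop⇔ j<n) (subst T (nthᵇ-occurrences v xs j (subst (_ <_) (sym (length-letters u)) j<n)) occ)
  ... | fits , o = subst (j + d ≤_) (length-letters u) fits , o
  to-drop : ∀ {j} → j < n → j + d ≤ n × OccursAt v (nth xs) j → T (nthᵇ occs j)
  to-drop {j} j<n (fits , o) = subst T (sym (nthᵇ-occurrences v xs j (subst (_ <_) (sym (length-letters u)) j<n)))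
    (Equivalence.from (drop⇔ j<n) (subst (j + d ≤_) (sym (length-letters u)) fits , o))

markedCount : Permutation′ d → (k n : ℕ) → List Bool → ℕ
markedCount v k n bs = count (λ u → bs ⊆ᵇ occurrences v (letters u)) (allWords k n)

rearrangeWord-marks : ∀ (v w : Permutation′ d) → Compatible v w → ∀ bs (u : Word k n) →
  T (bs ⊆ᵇ occurrences v (letters u)) → T (bs ⊆ᵇ occurrences w (letters (rearrangeWord (relabel v w) (nthᵇ bs) u)))
rearrangeWord-marks v w compatible bs u marked = Equivalence.from (T-⊆ᵇ-occurrences w bs _)
  (MarksOccurrences-rearrange v w compatible {U = nth (letters u)} (nth-rearrangeWord (relabel v w) (nthᵇ bs) u)
    (Equivalence.to (T-⊆ᵇ-occurrences v bs u) marked))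

markedCount-relabel : ∀ (v w : Permutation′ d) → Compatible v w → Compatible w v → ∀ k n bs →
  markedCount v k n bs ≡ markedCount w k n bs
markedCount-relabel v w compatible compatible′ k n bs =
  count-bijection (allWords-unique k n) (allWords-unique k n) record
    { to = rearrangeWord (relabel v w) (nthᵇ bs)
    ; from = rearrangeWord (relabel w v) (nthᵇ bs)
    ; to-∈ = λ u _ marked → ∈-allWords _ , rearrangeWord-marks v w compatible bs u marked
    ; from-∈ = λ u _ marked → ∈-allWords _ , rearrangeWord-marks w v compatible′ bs u marked
    ; from∘to = λ u _ marked → rearrangeWord-inverse v w compatible (nthᵇ bs) u (Equivalence.to (T-⊆ᵇ-occurrences v bs u) marked)
    ; to∘from = λ u _ marked → rearrangeWord-inverse w v compatible′ (nthᵇ bs) u (Equivalence.to (T-⊆ᵇ-occurrences w bs u) marked)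
    }

powerSum : Permutation′ d → (k n x : ℕ) → ℕ
powerSum v k n x = ∑ (allWords k n) (λ u → suc x ^ con v u)

con≡ones : ∀ (v : Permutation′ d) (u : Word k n) → con v u ≡ ones (occurrences v (letters u))
con≡ones v u = conList≡ones v (letters u)

length-occurrences-letters : ∀ (v : Permutation′ d) (u : Word k n) → length (occurrences v (letters u)) ≡ n
length-occurrences-letters v u = trans (length-occurrences v (letters u)) (length-letters u)

con≤length : ∀ (v : Permutation′ d) (u : Word k n) → con v u ≤ n
con≤length v u = subst₂ _≤_ (sym (con≡ones v u)) (length-occurrences-letters v u) (count≤length (λ b → b) (occurrences v (letters u)))

-- Counting pairs (word, set of marked occurrences) in two ways.
powerSum-expansion : ∀ (v : Permutation′ d) k n x →
  powerSum v k n x ≡ ∑ (bitLists n) (λ bs → x ^ ones bs * markedCount v k n bs)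
powerSum-expansion v k n x = begin
  ∑ W (λ u → suc x ^ con v u)
    ≡⟨ ∑-cong W (λ u _ → subsets u) ⟩
  ∑ W (λ u → ∑ (bitLists n) (λ bs → 𝟙 (bs ⊆ᵇ occs u) * x ^ ones bs))
    ≡⟨ ∑-comm W (bitLists n) _ ⟩
  ∑ (bitLists n) (λ bs → ∑ W (λ u → 𝟙 (bs ⊆ᵇ occs u) * x ^ ones bs))
    ≡⟨ ∑-cong (bitLists n) (λ bs _ → trans (∑-cong W (λ u _ → *-comm _ (x ^ ones bs))) (∑-*ˡ W (x ^ ones bs) _)) ⟩
  ∑ (bitLists n) (λ bs → x ^ ones bs * markedCount v k n bs) ∎
  where
  open ≡-Reasoning
  W = allWords k n
  occs : Word k n → List Bool
  occs u = occurrences v (letters u)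
  subsets : ∀ u → suc x ^ con v u ≡ ∑ (bitLists n) (λ bs → 𝟙 (bs ⊆ᵇ occs u) * x ^ ones bs)
  subsets u = begin
    suc x ^ con v u                                                       ≡⟨ cong (suc x ^_) (con≡ones v u) ⟩
    suc x ^ ones (occs u)                                                 ≡⟨ ∑-subsets x (occs u) ⟨
    ∑ (bitLists (length (occs u))) (λ bs → 𝟙 (bs ⊆ᵇ occs u) * x ^ ones bs) ≡⟨ cong (λ m → ∑ (bitLists m) (λ bs → 𝟙 (bs ⊆ᵇ occs u) * x ^ ones bs)) (length-occurrences-letters v u) ⟩
    ∑ (bitLists n) (λ bs → 𝟙 (bs ⊆ᵇ occs u) * x ^ ones bs)                  ∎

powerSum-relabel : ∀ (v w : Permutation′ d) → Compatible v w → Compatible w v → ∀ k n x →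
  powerSum v k n x ≡ powerSum w k n x
powerSum-relabel v w compatible compatible′ k n x = begin
  powerSum v k n x                                                ≡⟨ powerSum-expansion v k n x ⟩
  ∑ (bitLists n) (λ bs → x ^ ones bs * markedCount v k n bs)
    ≡⟨ ∑-cong (bitLists n) (λ bs _ → cong (x ^ ones bs *_) (markedCount-relabel v w compatible compatible′ k n bs)) ⟩
  ∑ (bitLists n) (λ bs → x ^ ones bs * markedCount w k n bs)      ≡⟨ powerSum-expansion w k n x ⟨
  powerSum w k n x                                                ∎
  where open ≡-Reasoning

-- The distribution of con over [k]^n is read off from the base-(1 + z) digits of a single
-- power sum, where z, the number of words, bounds every count.
g-from-powerSum : ∀ {d d′} (v : Permutation′ d) (w : Permutation′ d′) k n →
  powerSum v k n (length (allWords k n)) ≡ powerSum w k n (length (allWords k n)) →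
  ∀ r → g r v k n ≡ g r w k n
g-from-powerSum v w k n same-sum r = begin
  g r v k n   ≡⟨ length-filter (λ u → con v u ≟ r) W ⟩
  counts v r  ≡⟨ horner-injective (suc z) R (counts v) (counts w)
                   (λ r → s≤s (count≤length _ W)) (λ r → s≤s (count≤length _ W))
                   (trans (sym (digits v)) (trans same-sum (digits w))) r (s≤s (m≤n+m r n)) ⟩
  counts w r  ≡⟨ length-filter (λ u → con w u ≟ r) W ⟨
  g r w k n   ∎
  where
  open ≡-Reasoning
  W = allWords k n
  z = length W
  R = suc (n + r)
  counts : ∀ {d} → Permutation′ d → ℕ → ℕ
  counts v r = count (λ u → con v u ≡ᵇ r) W
  digits : ∀ {d} (v : Permutation′ d) → powerSum v k n z ≡ horner (suc z) (counts v) R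
  digits v = ∑-pow≡horner (suc z) R W (con v) (λ u _ → s≤s (≤-trans (con≤length v u) (m≤m+n n r)))

theorem1 : (d : ℕ) → 1 ≤ d → (v w : Permutation′ d) →
    (∀ i → InOverlap v i ⇔ InOverlap w i) →
    (∀ i → InOverlap v i →
       (∀ x → LetterSet v 0 (d ∸ i) x ⇔ LetterSet w 0 (d ∸ i) x) ×
       (∀ x → LetterSet v i d x ⇔ LetterSet w i d x)) →
    StronglyCWilfEquiv v w
theorem1 d _ v w same-overlaps same-letters k n =
  g-from-powerSum v w k n (powerSum-relabel v w compatible compatible′ k n _)
  where
  compatible : Compatible v w
  compatible i v-overlaps = record
    { w-overlaps = Equivalence.to (same-overlaps i) v-overlaps
    ; same-prefix = proj₁ (same-letters i v-overlaps)
    ; same-suffix = proj₂ (same-letters i v-overlaps)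
    }
  compatible′ : Compatible w v
  compatible′ i w-overlaps = record
    { w-overlaps = v-overlaps
    ; same-prefix = SameLetters-sym v w (proj₁ (same-letters i v-overlaps))
    ; same-suffix = SameLetters-sym v w (proj₂ (same-letters i v-overlaps))
    }
    where v-overlaps = Equivalence.from (same-overlaps i) w-overlaps
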